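{- Let $n$ be a positive integer. If $S\subseteq V(Q_n)$ consists of vertices that are pairwise at distance at most $2$ in $Q_n$, then either (i) $S\subseteq N_{Q_n}[v]$ for some $v\in V(Q_n)$, or (ii) $S$ induces a $4$-cycle (square) in $Q_n$, or (iii) $S$ is a subset of the vertex set of a subgraph of $Q_n$ isomorphic to $Q_3$, consisting of the four vertices of one of the two bipartition classes of that $Q_3$.
   Context: $Q_n$ is the $n$-dimensional hypercube: vertices are binary $n$-tuples, two adjacent iff they differ in exactly one coordinate; distance is the Hamming distance. $N_{Q_n}[v]$ is the closed neighborhood of $v$. -}

module Defs where

open import Data.Nat using (ℕ; zero; suc; _+_; _≤_)
open import Data.Bool using (Bool; true; false; _xor_; if_then_else_)
open import Data.Vec using (Vec; []; _∷_)
open import Data.Product using (Σ; _×_; _,_; ∃)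
open import Data.Sum using (_⊎_)
open import Relation.Binary.PropositionalEquality using (_≡_; _≢_)
open import Function.Definitions using (Injective)

Vertex : ℕ → Set
Vertex n = Vec Bool n

-- Hamming distance (= graph distance in Q_n).
dist : ∀ {n} → Vertex n → Vertex n → ℕ
dist [] [] = 0
dist (x ∷ xs) (y ∷ ys) = (if x xor y then 1 else 0) + dist xs ys

Adj : ∀ {n} → Vertex n → Vertex n → Set
Adj x y = dist x y ≡ 1

VSet : ℕ → Set
VSet n = Vertex n → Bool

_∈S_ : ∀ {n} → Vertex n → VSet n → Set
x ∈S S = S x ≡ true

_∈N[_] : ∀ {n} → Vertex n → Vertex n → Set
x ∈N[ v ] = dist x v ≤ 1

-- Parity of the Hamming weight (determines the bipartition class of Q_m).
parity : ∀ {m} → Vertex m → Bool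
parity [] = false
parity (b ∷ bs) = b xor parity bs

InClosedNbhd : ∀ {n} → VSet n → Set
InClosedNbhd {n} S = Σ (Vertex n) λ v → ∀ x → x ∈S S → x ∈N[ v ]

Induces4Cycle : ∀ {n} → VSet n → Set
Induces4Cycle {n} S =
  Σ (Vertex n) λ a → Σ (Vertex n) λ b → Σ (Vertex n) λ c → Σ (Vertex n) λ d →
    (a ≢ b × a ≢ c × a ≢ d × b ≢ c × b ≢ d × c ≢ d)
  × (∀ x → x ∈S S → (x ≡ a ⊎ x ≡ b ⊎ x ≡ c ⊎ x ≡ d))
  × (a ∈S S × b ∈S S × c ∈S S × d ∈S S)
  × (Adj a b × Adj b c × Adj c d × Adj d a)
  × ((Adj a c → Data.Empty.⊥) × (Adj b d → Data.Empty.⊥))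
  where import Data.Empty

record Q3Subgraph (n : ℕ) : Set where
  field
    φ        : Vertex 3 → Vertex n
    φ-inj    : Injective _≡_ _≡_ φ
    φ-edges  : ∀ x y → Adj x y → Adj (φ x) (φ y)

InQ3Class : ∀ {n} → VSet n → Set
InQ3Class {n} S =
  Σ (Q3Subgraph n) λ H → Σ Bool λ p →
    ∀ x → x ∈S S → Σ (Vertex 3) λ y → parity y ≡ p × Q3Subgraph.φ H y ≡ x

{-# OPTIONS --safe #-}
module Submission where

-- Fix x ∈ S. Unless S ⊆ N[x], S contains y = x + e_i + e_j, and every vertex
-- within distance 2 of both x and y is x + e_A with A one of ∅, {i}, {j}, {i,j},
-- {i,k}, {j,k}. Unless S ⊆ N[x + e_i] or S ⊆ N[x + e_j], S meets both
-- {x + e_j, x + e_j + e_k} and {x + e_i, x + e_i + e_k'}. The diameter bound leaves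
-- two possibilities: x + e_i, x + e_j ∈ S, and then S is the square x, x + e_i, y,
-- x + e_j; or x + e_j + e_k, x + e_i + e_k ∈ S with k = k', and then S lies in the
-- even class of the cube spanned by e_i, e_j, e_k at x. All distances are computed
-- through the isometric embedding of a subcube on distinct coordinates.

open import Defs
open import Data.Nat using (ℕ; zero; suc; _+_; _≤_; z≤n; s≤s)
import Data.Nat.Properties as Nat
open import Data.Nat.Properties using (≤-reflexive; ≤-antisym; ≰⇒>; m+1+n≰m; _≤?_)
open import Data.Bool using (true; false; not; _xor_; if_then_else_)
import Data.Bool.Properties as Bool
open import Data.Fin using (Fin; zero; suc; _≟_)
import Data.Fin.Properties as Fin
open import Data.Vec using (Vec; []; _∷_; lookup; updateAt; replicate)
open import Data.Vec.Properties using (lookup∘updateAt′)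
open import Data.Vec.Relation.Unary.All using (All; []; _∷_)
open import Data.Vec.Relation.Unary.Unique.Propositional using (Unique; []; _∷_)
open import Data.Product using (Σ-syntax; ∃; _×_; _,_)
open import Data.Sum using (_⊎_; inj₁; inj₂; [_,_])
open import Data.Empty using (⊥; ⊥-elim)
open import Function using (_∘_)
open import Relation.Nullary using (¬_; Dec; yes; no)
open import Relation.Nullary.Decidable using (map′; _⊎-dec_; _×-dec_; ¬?; decidable-stable)
open import Relation.Unary using (Decidable)
open import Relation.Binary.PropositionalEquality
  using (_≡_; _≢_; refl; sym; trans; cong; subst; ≢-sym; module ≡-Reasoning)

toggle : ∀ {n} → Fin n → Vertex n → Vertex n
toggle i x = updateAt x i not

toggle-comm : ∀ {n} (i j : Fin n) x → toggle i (toggle j x) ≡ toggle j (toggle i x)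
toggle-comm zero    zero    (b ∷ x) = refl
toggle-comm zero    (suc j) (b ∷ x) = refl
toggle-comm (suc i) zero    (b ∷ x) = refl
toggle-comm (suc i) (suc j) (b ∷ x) = cong (b ∷_) (toggle-comm i j x)

dist-refl : ∀ {n} (x : Vertex n) → dist x x ≡ 0
dist-refl []          = refl
dist-refl (false ∷ x) = dist-refl x
dist-refl (true ∷ x)  = dist-refl x

dist-sym : ∀ {n} (x y : Vertex n) → dist x y ≡ dist y x
dist-sym []          []          = refl
dist-sym (false ∷ x) (false ∷ y) = dist-sym x y
dist-sym (false ∷ x) (true ∷ y)  = cong suc (dist-sym x y)
dist-sym (true ∷ x)  (false ∷ y) = cong suc (dist-sym x y)
dist-sym (true ∷ x)  (true ∷ y)  = dist-sym x y

dist-toggle-both : ∀ {n} (i : Fin n) x y → dist (toggle i x) (toggle i y) ≡ dist x y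
dist-toggle-both zero    (false ∷ x) (false ∷ y) = refl
dist-toggle-both zero    (false ∷ x) (true ∷ y)  = refl
dist-toggle-both zero    (true ∷ x)  (false ∷ y) = refl
dist-toggle-both zero    (true ∷ x)  (true ∷ y)  = refl
dist-toggle-both (suc i) (a ∷ x)     (b ∷ y)     =
  cong ((if a xor b then 1 else 0) +_) (dist-toggle-both i x y)

dist-toggle-agreeˡ : ∀ {n} (i : Fin n) x y → lookup x i ≡ lookup y i →
                     dist (toggle i x) y ≡ suc (dist x y)
dist-toggle-agreeˡ zero    (false ∷ x) (false ∷ y) _ = refl
dist-toggle-agreeˡ zero    (true ∷ x)  (true ∷ y)  _ = refl
dist-toggle-agreeˡ (suc i) (false ∷ x) (false ∷ y) e = dist-toggle-agreeˡ i x y e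
dist-toggle-agreeˡ (suc i) (false ∷ x) (true ∷ y)  e = cong suc (dist-toggle-agreeˡ i x y e)
dist-toggle-agreeˡ (suc i) (true ∷ x)  (false ∷ y) e = cong suc (dist-toggle-agreeˡ i x y e)
dist-toggle-agreeˡ (suc i) (true ∷ x)  (true ∷ y)  e = dist-toggle-agreeˡ i x y e

dist-toggle-agreeʳ : ∀ {n} (i : Fin n) x y → lookup x i ≡ lookup y i →
                     dist x (toggle i y) ≡ suc (dist x y)
dist-toggle-agreeʳ i x y e = begin
  dist x (toggle i y) ≡⟨ dist-sym x (toggle i y) ⟩
  dist (toggle i y) x ≡⟨ dist-toggle-agreeˡ i y x (sym e) ⟩
  suc (dist y x)      ≡⟨ cong suc (dist-sym y x) ⟩
  suc (dist x y)      ∎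
  where open ≡-Reasoning

dist≡0⇒≡ : ∀ {n} {x y : Vertex n} → dist x y ≡ 0 → x ≡ y
dist≡0⇒≡ {x = []}          {[]}          _ = refl
dist≡0⇒≡ {x = false ∷ x} {false ∷ y} e = cong (false ∷_) (dist≡0⇒≡ e)
dist≡0⇒≡ {x = true ∷ x}  {true ∷ y}  e = cong (true ∷_) (dist≡0⇒≡ e)

dist≡1⇒toggle : ∀ {n} {x y : Vertex n} → dist x y ≡ 1 → ∃ λ k → y ≡ toggle k x
dist≡1⇒toggle {x = []}        {[]}        ()
dist≡1⇒toggle {x = false ∷ x} {true ∷ y}  e = zero , cong (true ∷_) (sym (dist≡0⇒≡ (Nat.suc-injective e)))
dist≡1⇒toggle {x = true ∷ x}  {false ∷ y} e = zero , cong (false ∷_) (sym (dist≡0⇒≡ (Nat.suc-injective e)))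
dist≡1⇒toggle {x = false ∷ x} {false ∷ y} e with dist≡1⇒toggle {x = x} {y} e
... | k , refl = suc k , refl
dist≡1⇒toggle {x = true ∷ x}  {true ∷ y}  e with dist≡1⇒toggle {x = x} {y} e
... | k , refl = suc k , refl

dist≡2⇒toggle² : ∀ {n} {x y : Vertex n} → dist x y ≡ 2 →
                 Σ[ a ∈ Fin n ] Σ[ b ∈ Fin n ] a ≢ b × y ≡ toggle a (toggle b x)
dist≡2⇒toggle² {x = []}        {[]}        ()
dist≡2⇒toggle² {x = false ∷ x} {true ∷ y}  e with dist≡1⇒toggle {x = x} {y} (Nat.suc-injective e)
... | k , refl = zero , suc k , (λ ()) , refl
dist≡2⇒toggle² {x = true ∷ x}  {false ∷ y} e with dist≡1⇒toggle {x = x} {y} (Nat.suc-injective e)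
... | k , refl = zero , suc k , (λ ()) , refl
dist≡2⇒toggle² {x = false ∷ x} {false ∷ y} e with dist≡2⇒toggle² {x = x} {y} e
... | a , b , a≢b , refl = suc a , suc b , a≢b ∘ Fin.suc-injective , refl
dist≡2⇒toggle² {x = true ∷ x}  {true ∷ y}  e with dist≡2⇒toggle² {x = x} {y} e
... | a , b , a≢b , refl = suc a , suc b , a≢b ∘ Fin.suc-injective , refl

flips : ∀ {m n} → Vec (Fin n) m → Vertex m → Vertex n → Vertex n
flips []       []           x = x
flips (i ∷ is) (false ∷ bs) x = flips is bs x
flips (i ∷ is) (true ∷ bs)  x = toggle i (flips is bs x)

lookup-flips : ∀ {m n} {t : Fin n} (is : Vec (Fin n) m) bs x → All (t ≢_) is →
               lookup (flips is bs x) t ≡ lookup x t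
lookup-flips []       []           x []            = refl
lookup-flips (i ∷ is) (false ∷ bs) x (_ ∷ t∉is)    = lookup-flips is bs x t∉is
lookup-flips (i ∷ is) (true ∷ bs)  x (t≢i ∷ t∉is) =
  trans (lookup∘updateAt′ _ i t≢i (flips is bs x)) (lookup-flips is bs x t∉is)

dist-flips : ∀ {m n} {is : Vec (Fin n) m} → Unique is → ∀ a b x →
             dist (flips is a x) (flips is b x) ≡ dist a b
dist-flips [] [] [] x = dist-refl x
dist-flips {is = i ∷ is} (i∉is ∷ is-unique) (a₀ ∷ a) (b₀ ∷ b) x =
  trans (step a₀ b₀) (cong ((if a₀ xor b₀ then 1 else 0) +_) (dist-flips is-unique a b x))
  where
  u v : Vertex _
  u = flips is a x
  v = flips is b x
  agree : lookup u i ≡ lookup v i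
  agree = trans (lookup-flips is a x i∉is) (sym (lookup-flips is b x i∉is))
  step : ∀ a₀ b₀ → dist (flips (i ∷ is) (a₀ ∷ a) x) (flips (i ∷ is) (b₀ ∷ b) x)
                 ≡ (if a₀ xor b₀ then 1 else 0) + dist u v
  step false false = refl
  step false true  = dist-toggle-agreeʳ i u v agree
  step true  false = dist-toggle-agreeˡ i u v agree
  step true  true  = dist-toggle-both i u v

flips-injective : ∀ {m n} {is : Vec (Fin n) m} → Unique is → ∀ {a b} x →
                  flips is a x ≡ flips is b x → a ≡ b
flips-injective {is = is} uniq {a} {b} x e = dist≡0⇒≡ (begin
  dist a b                             ≡⟨ dist-flips uniq a b x ⟨
  dist (flips is a x) (flips is b x)   ≡⟨ cong (dist (flips is a x)) e ⟨
  dist (flips is a x) (flips is a x)   ≡⟨ dist-refl (flips is a x) ⟩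
  0                                    ∎)
  where open ≡-Reasoning

flips-Q3Subgraph : ∀ {n} {is : Vec (Fin n) 3} → Unique is → Vertex n → Q3Subgraph n
flips-Q3Subgraph {is = is} uniq x = record
  { φ       = λ a → flips is a x
  ; φ-inj   = flips-injective uniq x
  ; φ-edges = λ a b a~b → trans (dist-flips uniq a b x) a~b
  }

dist-toggleʳ : ∀ {n} (i : Fin n) x → dist x (toggle i x) ≡ 1
dist-toggleʳ i = dist-flips ([] ∷ []) (false ∷ []) (true ∷ [])

dist-toggle²-toggle : ∀ {n} (i k : Fin n) x → dist (toggle i (toggle k x)) (toggle i x) ≡ 1
dist-toggle²-toggle i k x = trans (dist-toggle-both i (toggle k x) x)
                                  (trans (dist-sym (toggle k x) x) (dist-toggleʳ k x))

dist-toggle-toggle² : ∀ {n} {a b c : Fin n} → a ≢ b → a ≢ c → b ≢ c → ∀ x →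
                      dist (toggle a x) (toggle b (toggle c x)) ≡ 3
dist-toggle-toggle² a≢b a≢c b≢c =
  dist-flips ((a≢b ∷ a≢c ∷ []) ∷ (b≢c ∷ []) ∷ [] ∷ [])
             (true ∷ false ∷ false ∷ []) (false ∷ true ∷ true ∷ [])

dist-toggle²-toggle² : ∀ {n} {a b c d : Fin n} →
                       a ≢ b → a ≢ c → a ≢ d → b ≢ c → b ≢ d → c ≢ d → ∀ x →
                       dist (toggle a (toggle b x)) (toggle c (toggle d x)) ≡ 4
dist-toggle²-toggle² a≢b a≢c a≢d b≢c b≢d c≢d =
  dist-flips ((a≢b ∷ a≢c ∷ a≢d ∷ []) ∷ (b≢c ∷ b≢d ∷ []) ∷ (c≢d ∷ []) ∷ [] ∷ [])
             (true ∷ true ∷ false ∷ false ∷ []) (false ∷ false ∷ true ∷ true ∷ [])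

≡3+⇒≰2 : ∀ {m d} → m ≡ 3 + d → ¬ m ≤ 2
≡3+⇒≰2 refl = m+1+n≰m 2

data Ball₂ {n} (x : Vertex n) : Vertex n → Set where
  centre : Ball₂ x x
  one    : ∀ k → Ball₂ x (toggle k x)
  two    : ∀ {a b} → a ≢ b → Ball₂ x (toggle a (toggle b x))

ball₂ : ∀ {n} {x z : Vertex n} → dist x z ≤ 2 → Ball₂ x z
ball₂ {x = x} {z} x~z with dist x z in eq
... | 0 with refl ← dist≡0⇒≡ {x = x} {z} eq = centre
... | 1 with k , refl ← dist≡1⇒toggle {x = x} {z} eq = one k
... | 2 with a , b , a≢b , refl ← dist≡2⇒toggle² {x = x} {z} eq = two a≢b
ball₂ (s≤s (s≤s ())) | suc (suc (suc _))

data NearDiagonal {n} (x : Vertex n) (i j : Fin n) : Vertex n → Set where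
  at-x  : NearDiagonal x i j x
  at-i  : NearDiagonal x i j (toggle i x)
  at-j  : NearDiagonal x i j (toggle j x)
  at-ij : NearDiagonal x i j (toggle i (toggle j x))
  at-ik : ∀ {k} → k ≢ i → k ≢ j → NearDiagonal x i j (toggle i (toggle k x))
  at-jk : ∀ {k} → k ≢ i → k ≢ j → NearDiagonal x i j (toggle j (toggle k x))

near-diagonal : ∀ {n} {x z : Vertex n} {i j} → i ≢ j →
                dist x z ≤ 2 → dist z (toggle i (toggle j x)) ≤ 2 → NearDiagonal x i j z
near-diagonal {x = x} {z} {i} {j} i≢j x~z z~y with ball₂ {x = x} {z} x~z
... | centre = at-x
... | one k with k ≟ i | k ≟ j
...   | yes refl | _        = at-i
...   | no _     | yes refl = at-j
...   | no k≢i   | no k≢j   = ⊥-elim (≡3+⇒≰2 (dist-toggle-toggle² k≢i k≢j i≢j x) z~y)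
near-diagonal {x = x} {z} {i} {j} i≢j x~z z~y | two {a} {b} a≢b with a ≟ i | b ≟ j
... | yes refl | yes refl = at-ij
... | yes refl | no b≢j   = at-ik (≢-sym a≢b) b≢j
... | no a≢i   | yes refl = subst (NearDiagonal x i j) (toggle-comm b a x) (at-jk a≢i a≢b)
... | no a≢i   | no b≢j with a ≟ j | b ≟ i
...   | yes refl | yes refl = subst (NearDiagonal x i j) (toggle-comm b a x) at-ij
...   | yes refl | no b≢i   = at-jk b≢i b≢j
...   | no a≢j   | yes refl = subst (NearDiagonal x i j) (toggle-comm b a x) (at-ik a≢i a≢j)
...   | no a≢j   | no b≢i   =
  ⊥-elim (≡3+⇒≰2 (dist-toggle²-toggle² a≢b a≢i a≢j b≢i b≢j i≢j x) z~y)

near-diagonal-swap : ∀ {n} {x z : Vertex n} {i j} → NearDiagonal x i j z → NearDiagonal x j i z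
near-diagonal-swap at-x = at-x
near-diagonal-swap at-i = at-j
near-diagonal-swap at-j = at-i
near-diagonal-swap {x = x} {i = i} {j} at-ij = subst (NearDiagonal x j i) (toggle-comm j i x) at-ij
near-diagonal-swap (at-ik k≢i k≢j) = at-jk k≢j k≢i
near-diagonal-swap (at-jk k≢i k≢j) = at-ik k≢j k≢i

escape-toggle : ∀ {n} {x z : Vertex n} {i j} → NearDiagonal x i j z → ¬ z ∈N[ toggle i x ] →
                z ≡ toggle j x ⊎ Σ[ k ∈ Fin n ] k ≢ i × k ≢ j × z ≡ toggle j (toggle k x)
escape-toggle {x = x} {i = i} at-x z∉ = ⊥-elim (z∉ (≤-reflexive (dist-toggleʳ i x)))
escape-toggle {x = x} {i = i} at-i z∉ = ⊥-elim (z∉ (subst (_≤ 1) (sym (dist-refl (toggle i x))) z≤n))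
escape-toggle at-j z∉ = inj₁ refl
escape-toggle {x = x} {i = i} {j} at-ij z∉ = ⊥-elim (z∉ (≤-reflexive (dist-toggle²-toggle i j x)))
escape-toggle {x = x} {i = i} (at-ik {k} _ _) z∉ = ⊥-elim (z∉ (≤-reflexive (dist-toggle²-toggle i k x)))
escape-toggle (at-jk {k} k≢i k≢j) z∉ = inj₂ (k , k≢i , k≢j , refl)

∃-vertex? : ∀ {n} {P : Vertex n → Set} → Decidable P → Dec (∃ P)
∃-vertex? {zero} P? = map′ ([] ,_) (λ { ([] , p) → p }) (P? [])
∃-vertex? {suc n} {P} P? =
  map′ [ (λ (xs , p) → false ∷ xs , p) , (λ (xs , p) → true ∷ xs , p) ] split
       (∃-vertex? (P? ∘ (false ∷_)) ⊎-dec ∃-vertex? (P? ∘ (true ∷_)))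
  where
  split : ∃ P → ∃ (P ∘ (false ∷_)) ⊎ ∃ (P ∘ (true ∷_))
  split (false ∷ xs , p) = inj₁ (xs , p)
  split (true ∷ xs , p)  = inj₂ (xs , p)

covered? : ∀ {n} (S : VSet n) v →
           (∀ z → z ∈S S → z ∈N[ v ]) ⊎ (Σ[ z ∈ Vertex n ] z ∈S S × ¬ z ∈N[ v ])
covered? S v with ∃-vertex? (λ z → (S z Bool.≟ true) ×-dec ¬? (dist z v ≤? 1))
... | yes escapee  = inj₂ escapee
... | no ¬escapee = inj₁ λ z z∈S →
  decidable-stable (dist z v ≤? 1) (λ z∉ → ¬escapee (z , z∈S , z∉))

module _ {n} {S : VSet n} (diam₂ : ∀ x y → x ∈S S → y ∈S S → dist x y ≤ 2) where

  apart : ∀ {u v d} → u ∈S S → v ∈S S → dist u v ≡ 3 + d → ⊥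
  apart {u} {v} u∈S v∈S eq = ≡3+⇒≰2 eq (diam₂ u v u∈S v∈S)

  module _ {x : Vertex n} {i j : Fin n} (i≢j : i ≢ j)
           (x∈S : x ∈S S) (y∈S : toggle i (toggle j x) ∈S S) where

    near : ∀ {z} → z ∈S S → NearDiagonal x i j z
    near {z} z∈S = near-diagonal i≢j (diam₂ x z x∈S z∈S) (diam₂ z _ z∈S y∈S)

    square : toggle i x ∈S S → toggle j x ∈S S → Induces4Cycle S
    square xi∈S xj∈S =
      corner b₀₀ , corner b₁₀ , corner b₁₁ , corner b₀₁
      , ( corner-≢ b₀₀ b₁₀ (λ ()) , corner-≢ b₀₀ b₁₁ (λ ()) , corner-≢ b₀₀ b₀₁ (λ ())
        , corner-≢ b₁₀ b₁₁ (λ ()) , corner-≢ b₁₀ b₀₁ (λ ()) , corner-≢ b₁₁ b₀₁ (λ ()) )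
      , members
      , (x∈S , xi∈S , y∈S , xj∈S)
      , (corner-dist b₀₀ b₁₀ , corner-dist b₁₀ b₁₁ , corner-dist b₁₁ b₀₁ , corner-dist b₀₁ b₀₀)
      , (λ a~c → 2≢1 (trans (sym (corner-dist b₀₀ b₁₁)) a~c))
      , (λ b~d → 2≢1 (trans (sym (corner-dist b₁₀ b₀₁)) b~d))
      where
      b₀₀ b₁₀ b₁₁ b₀₁ : Vertex 2
      b₀₀ = false ∷ false ∷ []
      b₁₀ = true  ∷ false ∷ []
      b₁₁ = true  ∷ true  ∷ []
      b₀₁ = false ∷ true  ∷ []
      2≢1 : 2 ≢ 1
      2≢1 ()
      uniq : Unique (i ∷ j ∷ [])
      uniq = (i≢j ∷ []) ∷ [] ∷ []
      corner : Vertex 2 → Vertex n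
      corner b = flips (i ∷ j ∷ []) b x
      corner-dist : ∀ a b → dist (corner a) (corner b) ≡ dist a b
      corner-dist a b = dist-flips uniq a b x
      corner-≢ : ∀ a b → a ≢ b → corner a ≢ corner b
      corner-≢ _ _ a≢b = a≢b ∘ flips-injective uniq x
      members : ∀ z → z ∈S S → z ≡ x ⊎ z ≡ toggle i x ⊎ z ≡ toggle i (toggle j x) ⊎ z ≡ toggle j x
      members z z∈S with near z∈S
      ... | at-x  = inj₁ refl
      ... | at-i  = inj₂ (inj₁ refl)
      ... | at-ij = inj₂ (inj₂ (inj₁ refl))
      ... | at-j  = inj₂ (inj₂ (inj₂ refl))
      ... | at-ik k≢i k≢j =
        ⊥-elim (apart xj∈S z∈S (dist-toggle-toggle² (≢-sym i≢j) (≢-sym k≢j) (≢-sym k≢i) x))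
      ... | at-jk k≢i k≢j =
        ⊥-elim (apart xi∈S z∈S (dist-toggle-toggle² i≢j (≢-sym k≢i) (≢-sym k≢j) x))

    cube-class : ∀ {k} → k ≢ i → k ≢ j →
                 toggle i (toggle k x) ∈S S → toggle j (toggle k x) ∈S S → InQ3Class S
    cube-class {k} k≢i k≢j xik∈S xjk∈S = flips-Q3Subgraph uniq x , false , even
      where
      uniq : Unique (i ∷ j ∷ k ∷ [])
      uniq = (i≢j ∷ ≢-sym k≢i ∷ []) ∷ (≢-sym k≢j ∷ []) ∷ [] ∷ []
      even : ∀ z → z ∈S S → Σ[ b ∈ Vertex 3 ] parity b ≡ false × flips (i ∷ j ∷ k ∷ []) b x ≡ z
      even z z∈S with near z∈S
      ... | at-x  = (false ∷ false ∷ false ∷ []) , refl , refl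
      ... | at-ij = (true ∷ true ∷ false ∷ []) , refl , refl
      ... | at-i  = ⊥-elim (apart z∈S xjk∈S (dist-toggle-toggle² i≢j (≢-sym k≢i) (≢-sym k≢j) x))
      ... | at-j  = ⊥-elim (apart z∈S xik∈S (dist-toggle-toggle² (≢-sym i≢j) (≢-sym k≢j) (≢-sym k≢i) x))
      ... | at-ik {l} l≢i l≢j with l ≟ k
      ...   | yes refl = (true ∷ false ∷ true ∷ []) , refl , refl
      ...   | no l≢k   = ⊥-elim (apart z∈S xjk∈S
          (dist-toggle²-toggle² (≢-sym l≢i) i≢j (≢-sym k≢i) l≢j l≢k (≢-sym k≢j) x))
      even z z∈S | at-jk {l} l≢i l≢j with l ≟ k
      ...   | yes refl = (false ∷ true ∷ true ∷ []) , refl , refl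
      ...   | no l≢k   = ⊥-elim (apart z∈S xik∈S
          (dist-toggle²-toggle² (≢-sym l≢j) (≢-sym i≢j) (≢-sym k≢j) l≢i l≢k (≢-sym k≢i) x))

    resolve : ∀ {z₁ z₂} → z₁ ∈S S → z₂ ∈S S →
              z₁ ≡ toggle j x ⊎ Σ[ k ∈ Fin n ] k ≢ i × k ≢ j × z₁ ≡ toggle j (toggle k x) →
              z₂ ≡ toggle i x ⊎ Σ[ k ∈ Fin n ] k ≢ j × k ≢ i × z₂ ≡ toggle i (toggle k x) →
              Induces4Cycle S ⊎ InQ3Class S
    resolve z₁∈S z₂∈S (inj₁ refl) (inj₁ refl) = inj₁ (square z₂∈S z₁∈S)
    resolve z₁∈S z₂∈S (inj₁ refl) (inj₂ (k , k≢j , k≢i , refl)) =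
      ⊥-elim (apart z₁∈S z₂∈S (dist-toggle-toggle² (≢-sym i≢j) (≢-sym k≢j) (≢-sym k≢i) x))
    resolve z₁∈S z₂∈S (inj₂ (k , k≢i , k≢j , refl)) (inj₁ refl) =
      ⊥-elim (apart z₂∈S z₁∈S (dist-toggle-toggle² i≢j (≢-sym k≢i) (≢-sym k≢j) x))
    resolve z₁∈S z₂∈S (inj₂ (k , k≢i , k≢j , refl)) (inj₂ (l , l≢j , l≢i , refl)) with k ≟ l
    ... | yes refl = inj₂ (cube-class k≢i k≢j z₂∈S z₁∈S)
    ... | no k≢l   = ⊥-elim (apart z₁∈S z₂∈S
          (dist-toggle²-toggle² (≢-sym k≢j) (≢-sym i≢j) (≢-sym l≢j) k≢i k≢l (≢-sym l≢i) x))

    from-diagonal : InClosedNbhd S ⊎ Induces4Cycle S ⊎ InQ3Class S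
    from-diagonal with covered? S (toggle i x) | covered? S (toggle j x)
    ... | inj₁ S⊆N | _        = inj₁ (toggle i x , S⊆N)
    ... | inj₂ _   | inj₁ S⊆N = inj₁ (toggle j x , S⊆N)
    ... | inj₂ (z₁ , z₁∈S , z₁∉) | inj₂ (z₂ , z₂∈S , z₂∉) =
      inj₂ (resolve z₁∈S z₂∈S (escape-toggle (near z₁∈S) z₁∉)
                              (escape-toggle (near-diagonal-swap (near z₂∈S)) z₂∉))

  from-vertex : ∀ {x} → x ∈S S → InClosedNbhd S ⊎ Induces4Cycle S ⊎ InQ3Class S
  from-vertex {x} x∈S with covered? S x
  ... | inj₁ S⊆N = inj₁ (x , S⊆N)
  ... | inj₂ (y , y∈S , y∉)
    with i , j , i≢j , refl ← dist≡2⇒toggle² {x = x} {y}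
           (trans (dist-sym x y) (≤-antisym (diam₂ y x y∈S x∈S) (≰⇒> y∉)))
    = from-diagonal i≢j x∈S y∈S

proposition6p4 : (n : ℕ) → 1 ≤ n → (S : VSet n)
    → (∀ x y → x ∈S S → y ∈S S → dist x y ≤ 2)
    → InClosedNbhd S ⊎ Induces4Cycle S ⊎ InQ3Class S
proposition6p4 n _ S diam₂ with ∃-vertex? (λ z → S z Bool.≟ true)
... | yes (x , x∈S) = from-vertex diam₂ x∈S
... | no S≢∅        = inj₁ (replicate n false , λ z z∈S → ⊥-elim (S≢∅ (z , z∈S)))
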